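{- For every odd positive integer $n$, the polynomial $x^n+(1-x)^n+1\in\mathbb{Q}[x]$ is square-free, i.e. it has no repeated complex roots. -}

module Defs where

open import Data.Nat using (ℕ; zero; suc)
open import Data.Rational using (ℚ; 0ℚ; 1ℚ; -_) renaming (_+_ to _+ℚ_; _*_ to _*ℚ_)
open import Data.List using (List; []; _∷_; map)
open import Relation.Binary.PropositionalEquality using (_≡_)

-- Polynomials over ℚ as coefficient lists, constant term first:
-- a₀ ∷ a₁ ∷ … represents a₀ + a₁ x + …  (trailing zeros allowed).
Poly : Set
Poly = List ℚ

coeff : Poly → ℕ → ℚ
coeff []       _       = 0ℚ
coeff (a ∷ p)  zero    = a
coeff (a ∷ p)  (suc k) = coeff p k

infix 4 _≈P_
_≈P_ : Poly → Poly → Set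
p ≈P q = ∀ k → coeff p k ≡ coeff q k

infixl 6 _+P_
_+P_ : Poly → Poly → Poly
[]      +P q       = q
(a ∷ p) +P []      = a ∷ p
(a ∷ p) +P (b ∷ q) = (a +ℚ b) ∷ (p +P q)

scaleP : ℚ → Poly → Poly
scaleP a p = map (a *ℚ_) p

infixl 7 _*P_
_*P_ : Poly → Poly → Poly
[]      *P q = []
(a ∷ p) *P q = scaleP a q +P (0ℚ ∷ (p *P q))

oneP : Poly
oneP = 1ℚ ∷ []

X : Poly
X = 0ℚ ∷ 1ℚ ∷ []

oneMinusX : Poly
oneMinusX = 1ℚ ∷ (- 1ℚ) ∷ []

_^P_ : Poly → ℕ → Poly
p ^P zero  = oneP
p ^P suc n = p *P (p ^P n)

-- constant polynomial (degree ≤ 0), i.e. a unit or zero in ℚ[x]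
IsConstant : Poly → Set
IsConstant g = ∀ k → coeff g (suc k) ≡ 0ℚ

SquareFree : Poly → Set
SquareFree f = ∀ (g h : Poly) → f ≈P g *P g *P h → IsConstant g

fPoly : ℕ → Poly
fPoly n = (X ^P n) +P (oneMinusX ^P n) +P oneP

module Submission where

-- Let n = 2m + 1, M = n − 1 and f = xⁿ + (1 − x)ⁿ + 1, and suppose g² divides f with deg g > 0.
-- Then g divides f and f′ = n x^M − n (1 − x)^M, hence also n f + (1 − x) f′ = n (x^M + 1).
-- For M = 0 the right-hand side is a nonzero constant. Otherwise g divides x^{2M} − 1 with a
-- cofactor of degree < 2M, so g(T) kills a nonzero vector r of ℚ^{2M}, T being the cyclic shift.
-- Then f(T) r = f′(T) r = 0, which forces T^M r = (1 − T)^M r = −r, and this is impossible for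
-- an orthogonal T and even M (see even-eigenvector≈0). Polynomials act on any ℚ-vector space with
-- an endomorphism by Horner's rule; the argument is carried out in that generality and applied to
-- ℚ[x] itself and to ℚ^{2M}.

open import Algebra.Bundles using (CommutativeMonoid)
import Algebra.Solver.CommutativeMonoid as CommutativeMonoidSolver
open import Data.Empty using (⊥; ⊥-elim)
open import Data.List using ([]; _∷_)
open import Data.Nat as ℕ using (ℕ; zero; suc; _<_; _≤_; z≤n; s≤s)
open import Data.Nat.DivMod using (_%_; _/_; m≡m%n+[m/n]*n)
open import Data.Nat.GeneralisedArithmetic using (fold; fold-+)
import Data.Nat.Properties as ℕ
open import Data.Product using (_,_; _×_; ∃; ∃₂; proj₁; proj₂)
open import Data.Rational as ℚ using (ℚ; 0ℚ; 1ℚ; _+_; _*_; -_)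
import Data.Rational.Properties as ℚ
open import Data.Rational.Solver using (module +-*-Solver)
open import Data.Sum using (_⊎_; inj₁; inj₂; [_,_]′)
open import Defs
open import Function using (_∘_)
open import Relation.Binary.Bundles using (Setoid)
open import Relation.Binary.Definitions using (tri<; tri≈; tri>)
open import Relation.Binary.PropositionalEquality using (_≡_; _≢_; refl; sym; trans; cong; cong₂; subst; module ≡-Reasoning)
import Relation.Binary.Reasoning.Setoid as SetoidReasoning
open import Relation.Binary.Structures using (IsEquivalence)
open import Relation.Nullary using (yes; no)

ℕ→ℚ : ℕ → ℚ
ℕ→ℚ zero    = 0ℚ
ℕ→ℚ (suc n) = 1ℚ + ℕ→ℚ n

ℕ→ℚ-nonNeg : ∀ n → 0ℚ ℚ.≤ ℕ→ℚ n
ℕ→ℚ-nonNeg zero    = ℚ.≤-refl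
ℕ→ℚ-nonNeg (suc n) = ℚ.+-mono-≤ (ℚ.<⇒≤ (ℚ.positive⁻¹ 1ℚ)) (ℕ→ℚ-nonNeg n)

ℕ→ℚ-suc≢0 : ∀ n → ℕ→ℚ (suc n) ≢ 0ℚ
ℕ→ℚ-suc≢0 n = ℚ.<⇒≢ (ℚ.+-mono-<-≤ (ℚ.positive⁻¹ 1ℚ) (ℕ→ℚ-nonNeg n)) ∘ sym

p≢0⇒p*q≡0⇒q≡0 : ∀ {p q} → p ≢ 0ℚ → p * q ≡ 0ℚ → q ≡ 0ℚ
p≢0⇒p*q≡0⇒q≡0 {p} {q} p≢0 pq≡0 = begin
  q                ≡⟨ sym (ℚ.*-identityˡ q) ⟩
  1ℚ * q           ≡⟨ cong (_* q) (sym (ℚ.*-inverseˡ p)) ⟩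
  ℚ.1/ p * p * q   ≡⟨ ℚ.*-assoc (ℚ.1/ p) p q ⟩
  ℚ.1/ p * (p * q) ≡⟨ cong (ℚ.1/ p *_) pq≡0 ⟩
  ℚ.1/ p * 0ℚ      ≡⟨ ℚ.*-zeroʳ (ℚ.1/ p) ⟩
  0ℚ               ∎
  where
  open ≡-Reasoning
  instance _ = ℚ.≢-nonZero p≢0

*-≢0 : ∀ {p q} → p ≢ 0ℚ → q ≢ 0ℚ → p * q ≢ 0ℚ
*-≢0 p≢0 q≢0 = q≢0 ∘ p≢0⇒p*q≡0⇒q≡0 p≢0

-- ℚ[X]-modules

record ℚ[X]-Module : Set₁ where
  infixl 6 _⊕_
  infixr 7 _·_
  infix 4 _≈_
  field
    V             : Set
    _≈_           : V → V → Set
    isEquivalence : IsEquivalence _≈_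
    0v            : V
    _⊕_           : V → V → V
    _·_           : ℚ → V → V
    T             : V → V
    ⊕-cong        : ∀ {v v′ w w′} → v ≈ v′ → w ≈ w′ → v ⊕ w ≈ v′ ⊕ w′
    ·-congˡ       : ∀ {a v w} → v ≈ w → a · v ≈ a · w
    T-cong        : ∀ {v w} → v ≈ w → T v ≈ T w
    ⊕-assoc       : ∀ u v w → (u ⊕ v) ⊕ w ≈ u ⊕ (v ⊕ w)
    ⊕-comm        : ∀ v w → v ⊕ w ≈ w ⊕ v
    ⊕-identityˡ   : ∀ v → 0v ⊕ v ≈ v
    ·-distribˡ-⊕  : ∀ a v w → a · (v ⊕ w) ≈ a · v ⊕ a · w
    ·-distribʳ-+  : ∀ a b v → (a + b) · v ≈ a · v ⊕ b · v
    ·-assoc       : ∀ a b v → (a * b) · v ≈ a · (b · v)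
    ·-identityˡ   : ∀ v → 1ℚ · v ≈ v
    ·-zeroˡ       : ∀ v → 0ℚ · v ≈ 0v
    T-⊕           : ∀ v w → T (v ⊕ w) ≈ T v ⊕ T w
    T-·           : ∀ a v → T (a · v) ≈ a · T v

  open IsEquivalence isEquivalence public
    renaming (refl to ≈-refl; sym to ≈-sym; trans to ≈-trans; reflexive to ≈-reflexive)

module Action (S : ℚ[X]-Module) where
  open ℚ[X]-Module S public

  setoid : Setoid _ _
  setoid = record { isEquivalence = isEquivalence }

  module ≈-Reasoning = SetoidReasoning setoid
  open ≈-Reasoning

  ⊕-identityʳ : ∀ v → v ⊕ 0v ≈ v
  ⊕-identityʳ v = ≈-trans (⊕-comm v 0v) (⊕-identityˡ v)

  ⊕-commutativeMonoid : CommutativeMonoid _ _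
  ⊕-commutativeMonoid = record
    { isCommutativeMonoid = record
      { isMonoid = record
        { isSemigroup = record
          { isMagma = record { isEquivalence = isEquivalence ; ∙-cong = ⊕-cong }
          ; assoc = ⊕-assoc }
        ; identity = ⊕-identityˡ , ⊕-identityʳ }
      ; comm = ⊕-comm } }

  module ⊕-Solver = CommutativeMonoidSolver ⊕-commutativeMonoid

  ⊕-interchange : ∀ u v w x → (u ⊕ v) ⊕ (w ⊕ x) ≈ (u ⊕ w) ⊕ (v ⊕ x)
  ⊕-interchange = ⊕-Solver.solve 4 (λ a b c d → (a ⊕′ b) ⊕′ (c ⊕′ d) ⊜ (a ⊕′ c) ⊕′ (b ⊕′ d)) ≈-refl
    where open ⊕-Solver using (_⊜_) renaming (_⊕_ to _⊕′_)

  ·-zeroʳ : ∀ a → a · 0v ≈ 0v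
  ·-zeroʳ a = begin
    a · 0v          ≈⟨ ·-congˡ (·-zeroˡ 0v) ⟨
    a · (0ℚ · 0v)   ≈⟨ ·-assoc a 0ℚ 0v ⟨
    (a * 0ℚ) · 0v   ≡⟨ cong (_· 0v) (ℚ.*-zeroʳ a) ⟩
    0ℚ · 0v         ≈⟨ ·-zeroˡ 0v ⟩
    0v              ∎

  T-zero : T 0v ≈ 0v
  T-zero = begin
    T 0v           ≈⟨ T-cong (·-zeroˡ 0v) ⟨
    T (0ℚ · 0v)    ≈⟨ T-· 0ℚ 0v ⟩
    0ℚ · T 0v      ≈⟨ ·-zeroˡ (T 0v) ⟩
    0v             ∎

  ·-comm : ∀ a b v → a · (b · v) ≈ b · (a · v)
  ·-comm a b v = begin
    a · (b · v)    ≈⟨ ·-assoc a b v ⟨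
    (a * b) · v    ≡⟨ cong (_· v) (ℚ.*-comm a b) ⟩
    (b * a) · v    ≈⟨ ·-assoc b a v ⟩
    b · (a · v)    ∎

  ⊕-inverseʳ : ∀ v → v ⊕ (- 1ℚ) · v ≈ 0v
  ⊕-inverseʳ v = begin
    v ⊕ (- 1ℚ) · v        ≈⟨ ⊕-cong (·-identityˡ v) ≈-refl ⟨
    1ℚ · v ⊕ (- 1ℚ) · v   ≈⟨ ·-distribʳ-+ 1ℚ (- 1ℚ) v ⟨
    (1ℚ + - 1ℚ) · v       ≈⟨ ·-zeroˡ v ⟩
    0v                    ∎

  ⊕≈0⇒≈-1· : ∀ {v w} → v ⊕ w ≈ 0v → v ≈ (- 1ℚ) · w
  ⊕≈0⇒≈-1· {v} {w} v⊕w≈0 = begin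
    v                           ≈⟨ ⊕-identityʳ v ⟨
    v ⊕ 0v                      ≈⟨ ⊕-cong ≈-refl (⊕-inverseʳ w) ⟨
    v ⊕ (w ⊕ (- 1ℚ) · w)        ≈⟨ ⊕-assoc v w _ ⟨
    (v ⊕ w) ⊕ (- 1ℚ) · w        ≈⟨ ⊕-cong v⊕w≈0 ≈-refl ⟩
    0v ⊕ (- 1ℚ) · w             ≈⟨ ⊕-identityˡ _ ⟩
    (- 1ℚ) · w                  ∎

  -1·-involutive : ∀ v → (- 1ℚ) · ((- 1ℚ) · v) ≈ v
  -1·-involutive v = begin
    (- 1ℚ) · ((- 1ℚ) · v)   ≈⟨ ·-assoc (- 1ℚ) (- 1ℚ) v ⟨
    (- 1ℚ * - 1ℚ) · v       ≈⟨ ·-identityˡ v ⟩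
    v                       ∎

  ·-cancel : ∀ {a v} → a ≢ 0ℚ → a · v ≈ 0v → v ≈ 0v
  ·-cancel {a} {v} a≢0 av≈0 = begin
    v                   ≈⟨ ·-identityˡ v ⟨
    1ℚ · v              ≡⟨ cong (_· v) (sym (ℚ.*-inverseˡ a)) ⟩
    (ℚ.1/ a * a) · v    ≈⟨ ·-assoc (ℚ.1/ a) a v ⟩
    ℚ.1/ a · (a · v)    ≈⟨ ·-congˡ av≈0 ⟩
    ℚ.1/ a · 0v         ≈⟨ ·-zeroʳ (ℚ.1/ a) ⟩
    0v                  ∎
    where instance _ = ℚ.≢-nonZero a≢0

  act : Poly → V → V
  act []      v = 0v
  act (a ∷ p) v = a · v ⊕ T (act p v)

  U : V → V
  U = act oneMinusX

  act-cong : ∀ p {v w} → v ≈ w → act p v ≈ act p w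
  act-cong []      v≈w = ≈-refl
  act-cong (a ∷ p) v≈w = ⊕-cong (·-congˡ v≈w) (T-cong (act-cong p v≈w))

  act-zeroʳ : ∀ p → act p 0v ≈ 0v
  act-zeroʳ []      = ≈-refl
  act-zeroʳ (a ∷ p) = begin
    a · 0v ⊕ T (act p 0v)   ≈⟨ ⊕-cong (·-zeroʳ a) (T-cong (act-zeroʳ p)) ⟩
    0v ⊕ T 0v               ≈⟨ ⊕-identityˡ (T 0v) ⟩
    T 0v                    ≈⟨ T-zero ⟩
    0v                      ∎

  act-⊕ : ∀ p v w → act p (v ⊕ w) ≈ act p v ⊕ act p w
  act-⊕ []      v w = ≈-sym (⊕-identityˡ 0v)
  act-⊕ (a ∷ p) v w = begin
    a · (v ⊕ w) ⊕ T (act p (v ⊕ w))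
      ≈⟨ ⊕-cong (·-distribˡ-⊕ a v w) (≈-trans (T-cong (act-⊕ p v w)) (T-⊕ _ _)) ⟩
    (a · v ⊕ a · w) ⊕ (T (act p v) ⊕ T (act p w))
      ≈⟨ ⊕-interchange _ _ _ _ ⟩
    (a · v ⊕ T (act p v)) ⊕ (a · w ⊕ T (act p w))
      ∎

  act-· : ∀ p b v → act p (b · v) ≈ b · act p v
  act-· []      b v = ≈-sym (·-zeroʳ b)
  act-· (a ∷ p) b v = begin
    a · (b · v) ⊕ T (act p (b · v))
      ≈⟨ ⊕-cong (·-comm a b v) (≈-trans (T-cong (act-· p b v)) (T-· b _)) ⟩
    b · (a · v) ⊕ b · T (act p v)
      ≈⟨ ·-distribˡ-⊕ b _ _ ⟨
    b · (a · v ⊕ T (act p v))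
      ∎

  act-T : ∀ p v → act p (T v) ≈ T (act p v)
  act-T []      v = ≈-sym T-zero
  act-T (a ∷ p) v = begin
    a · T v ⊕ T (act p (T v))     ≈⟨ ⊕-cong (≈-sym (T-· a v)) (T-cong (act-T p v)) ⟩
    T (a · v) ⊕ T (T (act p v))   ≈⟨ T-⊕ _ _ ⟨
    T (a · v ⊕ T (act p v))       ∎

  act-+P : ∀ p q v → act (p +P q) v ≈ act p v ⊕ act q v
  act-+P []      q       v = ≈-sym (⊕-identityˡ _)
  act-+P (a ∷ p) []      v = ≈-sym (⊕-identityʳ _)
  act-+P (a ∷ p) (b ∷ q) v = begin
    (a + b) · v ⊕ T (act (p +P q) v)
      ≈⟨ ⊕-cong (·-distribʳ-+ a b v) (≈-trans (T-cong (act-+P p q v)) (T-⊕ _ _)) ⟩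
    (a · v ⊕ b · v) ⊕ (T (act p v) ⊕ T (act q v))
      ≈⟨ ⊕-interchange _ _ _ _ ⟩
    (a · v ⊕ T (act p v)) ⊕ (b · v ⊕ T (act q v))
      ∎

  act-scaleP : ∀ b p v → act (scaleP b p) v ≈ b · act p v
  act-scaleP b []      v = ≈-sym (·-zeroʳ b)
  act-scaleP b (a ∷ p) v = begin
    (b * a) · v ⊕ T (act (scaleP b p) v)
      ≈⟨ ⊕-cong (·-assoc b a v) (≈-trans (T-cong (act-scaleP b p v)) (T-· b _)) ⟩
    b · (a · v) ⊕ b · T (act p v)
      ≈⟨ ·-distribˡ-⊕ b _ _ ⟨
    b · (a · v ⊕ T (act p v))
      ∎

  act-shift : ∀ p v → act (0ℚ ∷ p) v ≈ T (act p v)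
  act-shift p v = ≈-trans (⊕-cong (·-zeroˡ v) ≈-refl) (⊕-identityˡ _)

  act-*P : ∀ p q v → act (p *P q) v ≈ act p (act q v)
  act-*P []      q v = ≈-refl
  act-*P (a ∷ p) q v = begin
    act (scaleP a q +P (0ℚ ∷ (p *P q))) v
      ≈⟨ act-+P (scaleP a q) _ v ⟩
    act (scaleP a q) v ⊕ act (0ℚ ∷ (p *P q)) v
      ≈⟨ ⊕-cong (act-scaleP a q v) (≈-trans (act-shift (p *P q) v) (T-cong (act-*P p q v))) ⟩
    a · act q v ⊕ T (act p (act q v))
      ∎

  act-comm : ∀ p q v → act p (act q v) ≈ act q (act p v)
  act-comm []      q v = ≈-sym (act-zeroʳ q)
  act-comm (a ∷ p) q v = begin
    a · act q v ⊕ T (act p (act q v))       ≈⟨ ⊕-cong (≈-sym (act-· q a v)) (T-cong (act-comm p q v)) ⟩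
    act q (a · v) ⊕ T (act q (act p v))     ≈⟨ ⊕-cong ≈-refl (act-T q _) ⟨
    act q (a · v) ⊕ act q (T (act p v))     ≈⟨ act-⊕ q _ _ ⟨
    act q (a · v ⊕ T (act p v))             ∎

  act-zeroˡ : ∀ p v → p ≈P [] → act p v ≈ 0v
  act-zeroˡ []      v p≈0 = ≈-refl
  act-zeroˡ (a ∷ p) v p≈0 = begin
    a · v ⊕ T (act p v)   ≈⟨ ⊕-cong (≈-reflexive (cong (_· v) (p≈0 zero))) (T-cong (act-zeroˡ p v (p≈0 ∘ suc))) ⟩
    0ℚ · v ⊕ T 0v         ≈⟨ ⊕-cong (·-zeroˡ v) T-zero ⟩
    0v ⊕ 0v               ≈⟨ ⊕-identityˡ 0v ⟩
    0v                    ∎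

  act-≈P : ∀ p q v → p ≈P q → act p v ≈ act q v
  act-≈P []      []      v p≈q = ≈-refl
  act-≈P []      (b ∷ q) v p≈q = ≈-sym (act-zeroˡ (b ∷ q) v (sym ∘ p≈q))
  act-≈P (a ∷ p) []      v p≈q = act-zeroˡ (a ∷ p) v p≈q
  act-≈P (a ∷ p) (b ∷ q) v p≈q = ⊕-cong (≈-reflexive (cong (_· v) (p≈q zero))) (T-cong (act-≈P p q v (p≈q ∘ suc)))

  act-oneP : ∀ v → act oneP v ≈ v
  act-oneP v = ≈-trans (⊕-cong (·-identityˡ v) T-zero) (⊕-identityʳ v)

  act-X : ∀ v → act X v ≈ T v
  act-X v = ≈-trans (act-shift oneP v) (T-cong (act-oneP v))

  U-defn : ∀ v → U v ≈ v ⊕ (- 1ℚ) · T v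
  U-defn v = begin
    1ℚ · v ⊕ T ((- 1ℚ) · v ⊕ T 0v)   ≈⟨ ⊕-cong (·-identityˡ v) (T-cong (⊕-cong ≈-refl T-zero)) ⟩
    v ⊕ T ((- 1ℚ) · v ⊕ 0v)          ≈⟨ ⊕-cong ≈-refl (≈-trans (T-cong (⊕-identityʳ _)) (T-· _ v)) ⟩
    v ⊕ (- 1ℚ) · T v                 ∎

  fold-cong : ∀ {f g : V → V} n {v w} → (∀ {x y} → x ≈ y → f x ≈ g y) → v ≈ w → fold v f n ≈ fold w g n
  fold-cong zero    f≈g v≈w = v≈w
  fold-cong (suc n) f≈g v≈w = f≈g (fold-cong n f≈g v≈w)

  act-^P : ∀ p n v → act (p ^P n) v ≈ fold v (act p) n
  act-^P p zero    v = act-oneP v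
  act-^P p (suc n) v = ≈-trans (act-*P p (p ^P n) v) (act-cong p (act-^P p n v))

  fold-commute : ∀ {f g : V → V} → (∀ {x y} → x ≈ y → g x ≈ g y) → (∀ x → f (g x) ≈ g (f x)) →
                 ∀ n v → f (fold v g n) ≈ fold (f v) g n
  fold-commute g-cong fg≈gf zero    v = ≈-refl
  fold-commute g-cong fg≈gf (suc n) v = ≈-trans (fg≈gf _) (g-cong (fold-commute g-cong fg≈gf n v))

  T-fold-act : ∀ p n v → T (fold v (act p) n) ≈ fold (T v) (act p) n
  T-fold-act p = fold-commute (act-cong p) (λ x → ≈-sym (act-T p x))

  act-fold-T : ∀ p n v → act p (fold v T n) ≈ fold (act p v) T n
  act-fold-T p = fold-commute T-cong (act-T p)

  fold-T-· : ∀ a n v → fold (a · v) T n ≈ a · fold v T n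
  fold-T-· a n v = ≈-sym (fold-commute T-cong (λ x → ≈-sym (T-· a x)) n v)

  fold-T-⊕ : ∀ n v w → fold (v ⊕ w) T n ≈ fold v T n ⊕ fold w T n
  fold-T-⊕ zero    v w = ≈-refl
  fold-T-⊕ (suc n) v w = ≈-trans (T-cong (fold-T-⊕ n v w)) (T-⊕ _ _)

  act-fold-shift : ∀ n p v → act (fold p (0ℚ ∷_) n) v ≈ fold (act p v) T n
  act-fold-shift zero    p v = ≈-refl
  act-fold-shift (suc n) p v = ≈-trans (act-shift (fold p (0ℚ ∷_) n) v) (T-cong (act-fold-shift n p v))

  act-fPoly : ∀ n w → act (fPoly n) w ≈ (fold w T n ⊕ fold w U n) ⊕ w
  act-fPoly n w = begin
    act (X ^P n +P oneMinusX ^P n +P oneP) w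
      ≈⟨ act-+P (X ^P n +P oneMinusX ^P n) oneP w ⟩
    act (X ^P n +P oneMinusX ^P n) w ⊕ act oneP w
      ≈⟨ ⊕-cong (act-+P (X ^P n) (oneMinusX ^P n) w) (act-oneP w) ⟩
    (act (X ^P n) w ⊕ act (oneMinusX ^P n) w) ⊕ w
      ≈⟨ ⊕-cong (⊕-cong (≈-trans (act-^P X n w) (fold-cong n (λ x≈y → ≈-trans (act-X _) (T-cong x≈y)) ≈-refl))
                        (act-^P oneMinusX n w)) ≈-refl ⟩
    (fold w T n ⊕ fold w U n) ⊕ w
      ∎

  T-⊕-U : ∀ v → T v ⊕ U v ≈ v
  T-⊕-U v = begin
    T v ⊕ U v                     ≈⟨ ⊕-cong ≈-refl (U-defn v) ⟩
    T v ⊕ (v ⊕ (- 1ℚ) · T v)      ≈⟨ ⊕-assoc _ _ _ ⟨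
    (T v ⊕ v) ⊕ (- 1ℚ) · T v      ≈⟨ ⊕-cong (⊕-comm _ _) ≈-refl ⟩
    (v ⊕ T v) ⊕ (- 1ℚ) · T v      ≈⟨ ⊕-assoc _ _ _ ⟩
    v ⊕ (T v ⊕ (- 1ℚ) · T v)      ≈⟨ ⊕-cong ≈-refl (⊕-inverseʳ (T v)) ⟩
    v ⊕ 0v                        ≈⟨ ⊕-identityʳ v ⟩
    v                             ∎

derivative : Poly → Poly
derivative []      = []
derivative (a ∷ p) = p +P (0ℚ ∷ derivative p)

-- T acts on pairs by the Jordan block [[T, 1], [0, T]], hence a polynomial p acts by
-- [[p(T), p′(T)], [0, p(T)]] (act-dual): derivatives are read off from this action.
dual : ℚ[X]-Module → ℚ[X]-Module
dual S = record
  { V             = V × V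
  ; _≈_           = λ (a , b) (a′ , b′) → a ≈ a′ × b ≈ b′
  ; isEquivalence = record
    { refl  = ≈-refl , ≈-refl
    ; sym   = λ (a≈ , b≈) → ≈-sym a≈ , ≈-sym b≈
    ; trans = λ (a≈ , b≈) (a≈′ , b≈′) → ≈-trans a≈ a≈′ , ≈-trans b≈ b≈′ }
  ; 0v            = 0v , 0v
  ; _⊕_           = λ (a , b) (a′ , b′) → a ⊕ a′ , b ⊕ b′
  ; _·_           = λ c (a , b) → c · a , c · b
  ; T             = λ (a , b) → T a ⊕ b , T b
  ; ⊕-cong        = λ (a≈ , b≈) (a≈′ , b≈′) → ⊕-cong a≈ a≈′ , ⊕-cong b≈ b≈′
  ; ·-congˡ       = λ (a≈ , b≈) → ·-congˡ a≈ , ·-congˡ b≈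
  ; T-cong        = λ (a≈ , b≈) → ⊕-cong (T-cong a≈) b≈ , T-cong b≈
  ; ⊕-assoc       = λ _ _ _ → ⊕-assoc _ _ _ , ⊕-assoc _ _ _
  ; ⊕-comm        = λ _ _ → ⊕-comm _ _ , ⊕-comm _ _
  ; ⊕-identityˡ   = λ _ → ⊕-identityˡ _ , ⊕-identityˡ _
  ; ·-distribˡ-⊕  = λ _ _ _ → ·-distribˡ-⊕ _ _ _ , ·-distribˡ-⊕ _ _ _
  ; ·-distribʳ-+  = λ _ _ _ → ·-distribʳ-+ _ _ _ , ·-distribʳ-+ _ _ _
  ; ·-assoc       = λ _ _ _ → ·-assoc _ _ _ , ·-assoc _ _ _
  ; ·-identityˡ   = λ _ → ·-identityˡ _ , ·-identityˡ _
  ; ·-zeroˡ       = λ _ → ·-zeroˡ _ , ·-zeroˡ _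
  ; T-⊕           = λ _ _ → ≈-trans (⊕-cong (T-⊕ _ _) ≈-refl) (⊕-interchange _ _ _ _) , T-⊕ _ _
  ; T-·           = λ _ _ → ≈-trans (⊕-cong (T-· _ _) ≈-refl) (≈-sym (·-distribˡ-⊕ _ _ _)) , T-· _ _
  }
  where open Action S

module Derivative (S : ℚ[X]-Module) where
  open Action S public
  open ≈-Reasoning
  private module D = Action (dual S)

  act-dual : ∀ p a b → D.act p (a , b) D.≈ (act p a ⊕ act (derivative p) b , act p b)
  act-dual []      a b = ≈-sym (⊕-identityˡ 0v) , ≈-refl
  act-dual (c ∷ p) a b = first , ⊕-cong ≈-refl (T-cong (proj₂ IH))
    where
    IH : D.act p (a , b) D.≈ (act p a ⊕ act (derivative p) b , act p b)
    IH = act-dual p a b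
    first : c · a ⊕ (T (proj₁ (D.act p (a , b))) ⊕ proj₂ (D.act p (a , b)))
            ≈ (c · a ⊕ T (act p a)) ⊕ act (p +P (0ℚ ∷ derivative p)) b
    first = begin
      c · a ⊕ (T (proj₁ (D.act p (a , b))) ⊕ proj₂ (D.act p (a , b)))
        ≈⟨ ⊕-cong ≈-refl (⊕-cong (≈-trans (T-cong (proj₁ IH)) (T-⊕ _ _)) (proj₂ IH)) ⟩
      c · a ⊕ ((T (act p a) ⊕ T (act (derivative p) b)) ⊕ act p b)
        ≈⟨ ⊕-cong ≈-refl (⊕-assoc _ _ _) ⟩
      c · a ⊕ (T (act p a) ⊕ (T (act (derivative p) b) ⊕ act p b))
        ≈⟨ ⊕-assoc _ _ _ ⟨
      (c · a ⊕ T (act p a)) ⊕ (T (act (derivative p) b) ⊕ act p b)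
        ≈⟨ ⊕-cong ≈-refl (⊕-comm _ _) ⟩
      (c · a ⊕ T (act p a)) ⊕ (act p b ⊕ T (act (derivative p) b))
        ≈⟨ ⊕-cong ≈-refl (⊕-cong ≈-refl (act-shift (derivative p) b)) ⟨
      (c · a ⊕ T (act p a)) ⊕ (act p b ⊕ act (0ℚ ∷ derivative p) b)
        ≈⟨ ⊕-cong ≈-refl (act-+P p (0ℚ ∷ derivative p) b) ⟨
      (c · a ⊕ T (act p a)) ⊕ act (p +P (0ℚ ∷ derivative p)) b
        ∎

  act-dual-from-0 : ∀ p w → D.act p (0v , w) D.≈ (act (derivative p) w , act p w)
  act-dual-from-0 p w = D.≈-trans (act-dual p 0v w) (≈-trans (⊕-cong (act-zeroʳ p) ≈-refl) (⊕-identityˡ _) , ≈-refl)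

  act-derivative-≈P : ∀ p q w → p ≈P q → act (derivative p) w ≈ act (derivative q) w
  act-derivative-≈P p q w p≈q =
    proj₁ (D.≈-trans (D.≈-sym (act-dual-from-0 p w)) (D.≈-trans (D.act-≈P p q (0v , w) p≈q) (act-dual-from-0 q w)))

  act-derivative-*P : ∀ p q w → act (derivative (p *P q)) w ≈ act p (act (derivative q) w) ⊕ act (derivative p) (act q w)
  act-derivative-*P p q w = proj₁ (D.≈-trans (D.≈-sym (act-dual-from-0 (p *P q) w))
    (D.≈-trans (D.act-*P p q (0v , w)) (D.≈-trans (D.act-cong p (act-dual-from-0 q w)) (act-dual p _ _))))

  act-derivative-oneMinusX : ∀ v → act (derivative oneMinusX) v ≈ (- 1ℚ) · v
  act-derivative-oneMinusX v = begin
    act (derivative oneMinusX) v   ≈⟨ act-≈P (derivative oneMinusX) ((- 1ℚ) ∷ []) v coeff≡ ⟩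
    (- 1ℚ) · v ⊕ T 0v              ≈⟨ ⊕-cong ≈-refl T-zero ⟩
    (- 1ℚ) · v ⊕ 0v                ≈⟨ ⊕-identityʳ _ ⟩
    (- 1ℚ) · v                     ∎
    where
    coeff≡ : derivative oneMinusX ≈P (- 1ℚ) ∷ []
    coeff≡ zero          = ℚ.+-identityʳ (- 1ℚ)
    coeff≡ (suc zero)    = refl
    coeff≡ (suc (suc k)) = refl

  dual-T^suc : ∀ k w → fold (0v , w) D.T (suc k) D.≈ (ℕ→ℚ (suc k) · fold w T k , fold w T (suc k))
  dual-T^suc zero w = first , ≈-refl
    where
    first : T 0v ⊕ w ≈ (1ℚ + 0ℚ) · w
    first = begin
      T 0v ⊕ w          ≈⟨ ⊕-cong T-zero ≈-refl ⟩
      0v ⊕ w            ≈⟨ ⊕-identityˡ w ⟩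
      w                 ≈⟨ ·-identityˡ w ⟨
      1ℚ · w            ≡⟨ cong (_· w) (sym (ℚ.+-identityʳ 1ℚ)) ⟩
      (1ℚ + 0ℚ) · w     ∎
  dual-T^suc (suc k) w = first , T-cong (proj₂ IH)
    where
    c : ℚ
    c = ℕ→ℚ (suc k)
    A : V
    A = fold w T k
    IH : fold (0v , w) D.T (suc k) D.≈ (c · A , T A)
    IH = dual-T^suc k w
    first : T (proj₁ (fold (0v , w) D.T (suc k))) ⊕ proj₂ (fold (0v , w) D.T (suc k)) ≈ (1ℚ + c) · T A
    first = begin
      T (proj₁ (fold (0v , w) D.T (suc k))) ⊕ proj₂ (fold (0v , w) D.T (suc k))
                            ≈⟨ ⊕-cong (T-cong (proj₁ IH)) (proj₂ IH) ⟩
      T (c · A) ⊕ T A       ≈⟨ ⊕-cong (T-· c A) (≈-sym (·-identityˡ (T A))) ⟩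
      c · T A ⊕ 1ℚ · T A    ≈⟨ ·-distribʳ-+ c 1ℚ (T A) ⟨
      (c + 1ℚ) · T A        ≡⟨ cong (_· T A) (ℚ.+-comm c 1ℚ) ⟩
      (1ℚ + c) · T A        ∎

  dual-U : ∀ a b → D.U (a , b) D.≈ (U a ⊕ (- 1ℚ) · b , U b)
  dual-U a b = D.≈-trans (act-dual oneMinusX a b) (⊕-cong ≈-refl (act-derivative-oneMinusX b) , ≈-refl)

  dual-U^suc : ∀ k w → fold (0v , w) D.U (suc k) D.≈ ((- ℕ→ℚ (suc k)) · fold w U k , fold w U (suc k))
  dual-U^suc zero w = D.≈-trans (dual-U 0v w) (first , ≈-refl)
    where
    first : U 0v ⊕ (- 1ℚ) · w ≈ (- (1ℚ + 0ℚ)) · w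
    first = begin
      U 0v ⊕ (- 1ℚ) · w     ≈⟨ ⊕-cong (act-zeroʳ oneMinusX) ≈-refl ⟩
      0v ⊕ (- 1ℚ) · w       ≈⟨ ⊕-identityˡ _ ⟩
      (- 1ℚ) · w            ≡⟨ cong (λ c → (- c) · w) (sym (ℚ.+-identityʳ 1ℚ)) ⟩
      (- (1ℚ + 0ℚ)) · w     ∎
  dual-U^suc (suc k) w = D.≈-trans (D.act-cong oneMinusX (dual-U^suc k w)) (D.≈-trans (dual-U _ _) (first , ≈-refl))
    where
    c : ℚ
    c = ℕ→ℚ (suc k)
    B : V
    B = fold w U k
    first : U ((- c) · B) ⊕ (- 1ℚ) · U B ≈ (- (1ℚ + c)) · U B
    first = begin
      U ((- c) · B) ⊕ (- 1ℚ) · U B     ≈⟨ ⊕-cong (act-· oneMinusX (- c) B) ≈-refl ⟩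
      (- c) · U B ⊕ (- 1ℚ) · U B       ≈⟨ ·-distribʳ-+ (- c) (- 1ℚ) (U B) ⟨
      (- c + - 1ℚ) · U B               ≡⟨ cong (_· U B) (trans (ℚ.+-comm (- c) (- 1ℚ)) (sym (ℚ.neg-distrib-+ 1ℚ c))) ⟩
      (- (1ℚ + c)) · U B               ∎

  act-derivative-fPoly : ∀ M w → act (derivative (fPoly (suc M))) w
                                 ≈ ℕ→ℚ (suc M) · fold w T M ⊕ (- ℕ→ℚ (suc M)) · fold w U M
  act-derivative-fPoly M w = ≈-trans (proj₁ (D.≈-trans (D.≈-sym (act-dual-from-0 (fPoly (suc M)) w))
    (D.≈-trans (D.act-fPoly (suc M) (0v , w)) (D.⊕-cong (D.⊕-cong (dual-T^suc M w) (dual-U^suc M w)) D.≈-refl))))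
    (⊕-identityʳ _)

module SquareFactor (S : ℚ[X]-Module) where
  open Derivative S public
  open ≈-Reasoning

  fPoly-identity : ∀ M w → let c = ℕ→ℚ (suc M); f = fPoly (suc M) in
                   c · (fold w T M ⊕ w) ≈ c · act f w ⊕ U (act (derivative f) w)
  fPoly-identity M w = ≈-sym (begin
    c · act f w ⊕ U (act (derivative f) w)
      ≈⟨ ⊕-cong (·-congˡ (act-fPoly (suc M) w)) (act-cong oneMinusX (act-derivative-fPoly M w)) ⟩
    c · ((T A ⊕ U B) ⊕ w) ⊕ U (c · A ⊕ (- c) · B)
      ≈⟨ ⊕-cong (≈-trans (·-distribˡ-⊕ _ _ _) (⊕-cong (·-distribˡ-⊕ _ _ _) ≈-refl))
                (≈-trans (act-⊕ oneMinusX _ _) (⊕-cong (act-· oneMinusX c A) (act-· oneMinusX (- c) B))) ⟩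
    ((c · T A ⊕ c · U B) ⊕ c · w) ⊕ (c · U A ⊕ (- c) · U B)
      ≈⟨ regroup (c · T A) (c · U B) (c · w) (c · U A) ((- c) · U B) ⟩
    (c · T A ⊕ c · U A) ⊕ ((c · U B ⊕ (- c) · U B) ⊕ c · w)
      ≈⟨ ⊕-cong (≈-trans (≈-sym (·-distribˡ-⊕ _ _ _)) (·-congˡ (T-⊕-U A)))
                (⊕-cong (≈-trans (≈-sym (·-distribʳ-+ _ _ _)) (≈-trans (≈-reflexive (cong (_· U B) (ℚ.+-inverseʳ c))) (·-zeroˡ _))) ≈-refl) ⟩
    c · A ⊕ (0v ⊕ c · w)
      ≈⟨ ⊕-cong ≈-refl (⊕-identityˡ _) ⟩
    c · A ⊕ c · w
      ≈⟨ ·-distribˡ-⊕ c A w ⟨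
    c · (A ⊕ w)
      ∎)
    where
    c : ℚ
    c = ℕ→ℚ (suc M)
    f : Poly
    f = fPoly (suc M)
    A B : V
    A = fold w T M
    B = fold w U M
    regroup : ∀ a b d e g → ((a ⊕ b) ⊕ d) ⊕ (e ⊕ g) ≈ (a ⊕ e) ⊕ ((b ⊕ g) ⊕ d)
    regroup = ⊕-Solver.solve 5 (λ a b d e g → ((a ⊕′ b) ⊕′ d) ⊕′ (e ⊕′ g) ⊜ (a ⊕′ e) ⊕′ ((b ⊕′ g) ⊕′ d)) ≈-refl
      where open ⊕-Solver using (_⊜_) renaming (_⊕_ to _⊕′_)

  act-square-factor : ∀ f g h w → f ≈P g *P g *P h → act f w ≈ act g (act g (act h w))
  act-square-factor f g h w f≈g²h = begin
    act f w                    ≈⟨ act-≈P f (g *P g *P h) w f≈g²h ⟩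
    act (g *P g *P h) w        ≈⟨ act-*P (g *P g) h w ⟩
    act (g *P g) (act h w)     ≈⟨ act-*P g g _ ⟩
    act g (act g (act h w))    ∎

  act-derivative-square-factor : ∀ f g h w → f ≈P g *P g *P h →
    act (derivative f) w ≈ act g (act (derivative (g *P h)) w ⊕ act (derivative g) (act h w))
  act-derivative-square-factor f g h w f≈g²h = begin
    act (derivative f) w
      ≈⟨ act-derivative-≈P f (g *P g *P h) w f≈g²h ⟩
    act (derivative (g *P g *P h)) w
      ≈⟨ act-derivative-*P (g *P g) h w ⟩
    act (g *P g) (act h′ w) ⊕ act (derivative (g *P g)) (act h w)
      ≈⟨ ⊕-cong (act-*P g g _) (act-derivative-*P g g _) ⟩
    act g (act g (act h′ w)) ⊕ (act g (act g′ (act h w)) ⊕ act g′ (act g (act h w)))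
      ≈⟨ ⊕-cong ≈-refl (⊕-cong ≈-refl (act-comm g′ g _)) ⟩
    act g (act g (act h′ w)) ⊕ (act g (act g′ (act h w)) ⊕ act g (act g′ (act h w)))
      ≈⟨ ⊕-assoc _ _ _ ⟨
    (act g (act g (act h′ w)) ⊕ act g (act g′ (act h w))) ⊕ act g (act g′ (act h w))
      ≈⟨ ⊕-cong (≈-trans (act-cong g (act-derivative-*P g h w)) (act-⊕ g _ _)) ≈-refl ⟨
    act g (act (derivative (g *P h)) w) ⊕ act g (act g′ (act h w))
      ≈⟨ act-⊕ g _ _ ⟨
    act g (act (derivative (g *P h)) w ⊕ act g′ (act h w))
      ∎
    where
    g′ h′ : Poly
    g′ = derivative g
    h′ = derivative h

  square-factor-annihilates : ∀ f g h {r} → f ≈P g *P g *P h → act g r ≈ 0v →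
                              act f r ≈ 0v × act (derivative f) r ≈ 0v
  square-factor-annihilates f g h {r} f≈g²h gr≈0 = fr≈0 , f′r≈0
    where
    annihilate : ∀ q → act g (act q r) ≈ 0v
    annihilate q = ≈-trans (act-comm g q r) (≈-trans (act-cong q gr≈0) (act-zeroʳ q))

    fr≈0 : act f r ≈ 0v
    fr≈0 = ≈-trans (act-square-factor f g h r f≈g²h) (≈-trans (act-cong g (annihilate h)) (act-zeroʳ g))

    f′r≈0 : act (derivative f) r ≈ 0v
    f′r≈0 = begin
      act (derivative f) r
        ≈⟨ act-derivative-square-factor f g h r f≈g²h ⟩
      act g (act (derivative (g *P h)) r ⊕ act (derivative g) (act h r))
        ≈⟨ act-⊕ g _ _ ⟩
      act g (act (derivative (g *P h)) r) ⊕ act g (act (derivative g) (act h r))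
        ≈⟨ ⊕-cong (annihilate (derivative (g *P h)))
                  (≈-trans (act-cong g (≈-sym (act-*P (derivative g) h r))) (annihilate (derivative g *P h))) ⟩
      0v ⊕ 0v
        ≈⟨ ⊕-identityˡ 0v ⟩
      0v
        ∎

  square-factor-image : ∀ M g h w → fPoly (suc M) ≈P g *P g *P h →
                        ∃ λ z → ℕ→ℚ (suc M) · (fold w T M ⊕ w) ≈ act g z
  square-factor-image M g h w f≈g²h = c · act g (act h w) ⊕ U Z , (begin
    c · (fold w T M ⊕ w)
      ≈⟨ fPoly-identity M w ⟩
    c · act f w ⊕ U (act (derivative f) w)
      ≈⟨ ⊕-cong (·-congˡ (act-square-factor f g h w f≈g²h)) (act-cong oneMinusX (act-derivative-square-factor f g h w f≈g²h)) ⟩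
    c · act g (act g (act h w)) ⊕ U (act g Z)
      ≈⟨ ⊕-cong (act-· g c _) (act-comm g oneMinusX Z) ⟨
    act g (c · act g (act h w)) ⊕ act g (U Z)
      ≈⟨ act-⊕ g _ _ ⟨
    act g (c · act g (act h w) ⊕ U Z)
      ∎)
    where
    c : ℚ
    c = ℕ→ℚ (suc M)
    f : Poly
    f = fPoly (suc M)
    Z : V
    Z = act (derivative (g *P h)) w ⊕ act (derivative g) (act h w)

  square-factor-kernel : ∀ M g h {r} → fPoly (suc M) ≈P g *P g *P h → act g r ≈ 0v →
                         fold r T M ≈ (- 1ℚ) · r × fold r U M ≈ (- 1ℚ) · r
  square-factor-kernel M g h {r} f≈g²h gr≈0 = T^Mr≈-r , U^Mr≈-r
    where
    c : ℚ
    c = ℕ→ℚ (suc M)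
    f : Poly
    f = fPoly (suc M)
    A B : V
    A = fold r T M
    B = fold r U M

    fr≈0 : act f r ≈ 0v
    fr≈0 = proj₁ (square-factor-annihilates f g h f≈g²h gr≈0)

    f′r≈0 : act (derivative f) r ≈ 0v
    f′r≈0 = proj₂ (square-factor-annihilates f g h f≈g²h gr≈0)

    T^Mr≈-r : A ≈ (- 1ℚ) · r
    T^Mr≈-r = ⊕≈0⇒≈-1· (·-cancel (ℕ→ℚ-suc≢0 M) (begin
      c · (A ⊕ r)                                 ≈⟨ fPoly-identity M r ⟩
      c · act f r ⊕ U (act (derivative f) r)      ≈⟨ ⊕-cong (·-congˡ fr≈0) (act-cong oneMinusX f′r≈0) ⟩
      c · 0v ⊕ U 0v                               ≈⟨ ⊕-cong (·-zeroʳ c) (act-zeroʳ oneMinusX) ⟩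
      0v ⊕ 0v                                     ≈⟨ ⊕-identityˡ 0v ⟩
      0v                                          ∎))

    A≈B : A ≈ B
    A≈B = ≈-trans (⊕≈0⇒≈-1· (·-cancel (ℕ→ℚ-suc≢0 M) (begin
      c · (A ⊕ (- 1ℚ) · B)                        ≈⟨ ·-distribˡ-⊕ c A _ ⟩
      c · A ⊕ c · ((- 1ℚ) · B)                    ≈⟨ ⊕-cong ≈-refl (·-assoc c (- 1ℚ) B) ⟨
      c · A ⊕ (c * - 1ℚ) · B                      ≡⟨ cong (λ d → c · A ⊕ d · B) (c*-1≡-c c) ⟩
      c · A ⊕ (- c) · B                           ≈⟨ act-derivative-fPoly M r ⟨
      act (derivative f) r                        ≈⟨ f′r≈0 ⟩
      0v                                          ∎))) (-1·-involutive B)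
      where
      open +-*-Solver
      c*-1≡-c : ∀ c → c * - 1ℚ ≡ - c
      c*-1≡-c = solve 1 (λ c → c :* (:- con 1ℚ) := :- c) refl

    U^Mr≈-r : B ≈ (- 1ℚ) · r
    U^Mr≈-r = ≈-trans (≈-sym A≈B) T^Mr≈-r

-- Polynomials and their degrees

coeff-+P : ∀ p q k → coeff (p +P q) k ≡ coeff p k + coeff q k
coeff-+P []      q       k       = sym (ℚ.+-identityˡ _)
coeff-+P (a ∷ p) []      k       = sym (ℚ.+-identityʳ _)
coeff-+P (a ∷ p) (b ∷ q) zero    = refl
coeff-+P (a ∷ p) (b ∷ q) (suc k) = coeff-+P p q k

coeff-scaleP : ∀ a p k → coeff (scaleP a p) k ≡ a * coeff p k
coeff-scaleP a []      k       = sym (ℚ.*-zeroʳ a)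
coeff-scaleP a (b ∷ p) zero    = refl
coeff-scaleP a (b ∷ p) (suc k) = coeff-scaleP a p k

module _ where
  open ≡-Reasoning

  +P-cong : ∀ {p p′ q q′} → p ≈P p′ → q ≈P q′ → p +P q ≈P p′ +P q′
  +P-cong {p} {p′} {q} {q′} p≈ q≈ k = begin
    coeff (p +P q) k          ≡⟨ coeff-+P p q k ⟩
    coeff p k + coeff q k     ≡⟨ cong₂ _+_ (p≈ k) (q≈ k) ⟩
    coeff p′ k + coeff q′ k   ≡⟨ coeff-+P p′ q′ k ⟨
    coeff (p′ +P q′) k        ∎

  scaleP-cong : ∀ {a p q} → p ≈P q → scaleP a p ≈P scaleP a q
  scaleP-cong {a} {p} {q} p≈q k = begin
    coeff (scaleP a p) k   ≡⟨ coeff-scaleP a p k ⟩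
    a * coeff p k          ≡⟨ cong (a *_) (p≈q k) ⟩
    a * coeff q k          ≡⟨ coeff-scaleP a q k ⟨
    coeff (scaleP a q) k   ∎

  +P-assoc : ∀ p q r → (p +P q) +P r ≈P p +P (q +P r)
  +P-assoc p q r k = begin
    coeff ((p +P q) +P r) k                 ≡⟨ coeff-+P (p +P q) r k ⟩
    coeff (p +P q) k + coeff r k            ≡⟨ cong (_+ coeff r k) (coeff-+P p q k) ⟩
    coeff p k + coeff q k + coeff r k       ≡⟨ ℚ.+-assoc (coeff p k) _ _ ⟩
    coeff p k + (coeff q k + coeff r k)     ≡⟨ cong (coeff p k +_) (coeff-+P q r k) ⟨
    coeff p k + coeff (q +P r) k            ≡⟨ coeff-+P p (q +P r) k ⟨
    coeff (p +P (q +P r)) k                 ∎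

  +P-comm : ∀ p q → p +P q ≈P q +P p
  +P-comm p q k = begin
    coeff (p +P q) k        ≡⟨ coeff-+P p q k ⟩
    coeff p k + coeff q k   ≡⟨ ℚ.+-comm (coeff p k) _ ⟩
    coeff q k + coeff p k   ≡⟨ coeff-+P q p k ⟨
    coeff (q +P p) k        ∎

  scaleP-distribˡ-+P : ∀ a p q → scaleP a (p +P q) ≈P scaleP a p +P scaleP a q
  scaleP-distribˡ-+P a p q k = begin
    coeff (scaleP a (p +P q)) k                   ≡⟨ coeff-scaleP a (p +P q) k ⟩
    a * coeff (p +P q) k                          ≡⟨ cong (a *_) (coeff-+P p q k) ⟩
    a * (coeff p k + coeff q k)                   ≡⟨ ℚ.*-distribˡ-+ a (coeff p k) _ ⟩
    a * coeff p k + a * coeff q k                 ≡⟨ cong₂ _+_ (coeff-scaleP a p k) (coeff-scaleP a q k) ⟨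
    coeff (scaleP a p) k + coeff (scaleP a q) k   ≡⟨ coeff-+P (scaleP a p) (scaleP a q) k ⟨
    coeff (scaleP a p +P scaleP a q) k            ∎

  scaleP-distribʳ-+ : ∀ a b p → scaleP (a + b) p ≈P scaleP a p +P scaleP b p
  scaleP-distribʳ-+ a b p k = begin
    coeff (scaleP (a + b) p) k                    ≡⟨ coeff-scaleP (a + b) p k ⟩
    (a + b) * coeff p k                           ≡⟨ ℚ.*-distribʳ-+ (coeff p k) a b ⟩
    a * coeff p k + b * coeff p k                 ≡⟨ cong₂ _+_ (coeff-scaleP a p k) (coeff-scaleP b p k) ⟨
    coeff (scaleP a p) k + coeff (scaleP b p) k   ≡⟨ coeff-+P (scaleP a p) (scaleP b p) k ⟨
    coeff (scaleP a p +P scaleP b p) k            ∎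

  scaleP-assoc : ∀ a b p → scaleP (a * b) p ≈P scaleP a (scaleP b p)
  scaleP-assoc a b p k = begin
    coeff (scaleP (a * b) p) k      ≡⟨ coeff-scaleP (a * b) p k ⟩
    a * b * coeff p k               ≡⟨ ℚ.*-assoc a b (coeff p k) ⟩
    a * (b * coeff p k)             ≡⟨ cong (a *_) (coeff-scaleP b p k) ⟨
    a * coeff (scaleP b p) k        ≡⟨ coeff-scaleP a (scaleP b p) k ⟨
    coeff (scaleP a (scaleP b p)) k ∎

  scaleP-identityˡ : ∀ p → scaleP 1ℚ p ≈P p
  scaleP-identityˡ p k = trans (coeff-scaleP 1ℚ p k) (ℚ.*-identityˡ (coeff p k))

  scaleP-zeroˡ : ∀ p → scaleP 0ℚ p ≈P []
  scaleP-zeroˡ p k = trans (coeff-scaleP 0ℚ p k) (ℚ.*-zeroˡ (coeff p k))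

shift-cong : ∀ {p q} → p ≈P q → (0ℚ ∷ p) ≈P (0ℚ ∷ q)
shift-cong p≈q zero    = refl
shift-cong p≈q (suc k) = p≈q k

shift-+P : ∀ p q → (0ℚ ∷ (p +P q)) ≈P (0ℚ ∷ p) +P (0ℚ ∷ q)
shift-+P p q zero    = sym (ℚ.+-identityˡ 0ℚ)
shift-+P p q (suc k) = refl

shift-scaleP : ∀ a p → (0ℚ ∷ scaleP a p) ≈P scaleP a (0ℚ ∷ p)
shift-scaleP a p zero    = sym (ℚ.*-zeroʳ a)
shift-scaleP a p (suc k) = refl

polynomials : ℚ[X]-Module
polynomials = record
  { V             = Poly
  ; _≈_           = _≈P_
  ; isEquivalence = record { refl = λ _ → refl ; sym = λ p≈q → sym ∘ p≈q ; trans = λ p≈q q≈r k → trans (p≈q k) (q≈r k) }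
  ; 0v            = []
  ; _⊕_           = _+P_
  ; _·_           = scaleP
  ; T             = 0ℚ ∷_
  ; ⊕-cong        = λ {p} {p′} {q} {q′} → +P-cong {p} {p′} {q} {q′}
  ; ·-congˡ       = λ {a} {p} {q} → scaleP-cong {a} {p} {q}
  ; T-cong        = λ {p} {q} → shift-cong {p} {q}
  ; ⊕-assoc       = +P-assoc
  ; ⊕-comm        = +P-comm
  ; ⊕-identityˡ   = λ _ _ → refl
  ; ·-distribˡ-⊕  = scaleP-distribˡ-+P
  ; ·-distribʳ-+  = scaleP-distribʳ-+
  ; ·-assoc       = scaleP-assoc
  ; ·-identityˡ   = scaleP-identityˡ
  ; ·-zeroˡ       = scaleP-zeroˡ
  ; T-⊕           = shift-+P
  ; T-·           = shift-scaleP
  }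

module P = SquareFactor polynomials

act≡*P : ∀ p q → P.act p q ≡ p *P q
act≡*P []      q = refl
act≡*P (a ∷ p) q = cong (λ r → scaleP a q +P (0ℚ ∷ r)) (act≡*P p q)

Degree≤ : Poly → ℕ → Set
Degree≤ p d = ∀ i → d < i → coeff p i ≡ 0ℚ

record HasDegree (p : Poly) (d : ℕ) : Set where
  constructor hasDegree
  field
    leading≢0 : coeff p d ≢ 0ℚ
    degree≤   : Degree≤ p d

open HasDegree

degree? : ∀ p → p ≈P [] ⊎ ∃ (HasDegree p)
degree? []      = inj₁ (λ _ → refl)
degree? (a ∷ p) with degree? p
... | inj₂ (d , hasDegree p_d≢0 p≤d) = inj₂ (suc d , hasDegree p_d≢0 λ { (suc i) (s≤s d<i) → p≤d i d<i })
... | inj₁ p≈0 with a ℚ.≟ 0ℚ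
...   | yes a≡0 = inj₁ λ { zero → a≡0 ; (suc i) → p≈0 i }
...   | no  a≢0 = inj₂ (0 , hasDegree a≢0 λ { (suc i) _ → p≈0 i })

HasDegree-unique : ∀ {p d e} → HasDegree p d → HasDegree p e → d ≡ e
HasDegree-unique {d = d} {e} deg-d deg-e with ℕ.<-cmp d e
... | tri< d<e _ _ = ⊥-elim (leading≢0 deg-e (degree≤ deg-d e d<e))
... | tri≈ _ d≡e _ = d≡e
... | tri> _ _ e<d = ⊥-elim (leading≢0 deg-d (degree≤ deg-e d e<d))

HasDegree-≈P : ∀ {p q d} → p ≈P q → HasDegree p d → HasDegree q d
HasDegree-≈P {d = d} p≈q (hasDegree p_d≢0 p≤d) =
  hasDegree (p_d≢0 ∘ trans (p≈q d)) (λ i d<i → trans (sym (p≈q i)) (p≤d i d<i))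

*P-zeroʳ : ∀ p {q} → q ≈P [] → p *P q ≈P []
*P-zeroʳ p {q} q≈0 k = subst (λ r → coeff r k ≡ 0ℚ) (act≡*P p q) (P.≈-trans {P.act p q} {P.act p []} {[]} (P.act-cong p {q} {[]} q≈0) (P.act-zeroʳ p) k)

coeff-*P-∷ : ∀ a p q i → coeff ((a ∷ p) *P q) i ≡ a * coeff q i + coeff (0ℚ ∷ (p *P q)) i
coeff-*P-∷ a p q i = trans (coeff-+P (scaleP a q) _ i) (cong (_+ coeff (0ℚ ∷ (p *P q)) i) (coeff-scaleP a q i))

*P-zeroˡ : ∀ p q → p ≈P [] → p *P q ≈P []
*P-zeroˡ p q p≈0 k = subst (λ r → coeff r k ≡ 0ℚ) (act≡*P p q) (P.act-zeroˡ p q p≈0 k)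

shift-zero : ∀ {p} → p ≈P [] → (0ℚ ∷ p) ≈P []
shift-zero p≈0 zero    = refl
shift-zero p≈0 (suc k) = p≈0 k

Degree≤0⇒tail≈0 : ∀ a p → Degree≤ (a ∷ p) 0 → p ≈P []
Degree≤0⇒tail≈0 a p a∷p≤0 i = a∷p≤0 (suc i) (s≤s z≤n)

*P-degree≤ : ∀ p q {d e} → Degree≤ p d → Degree≤ q e → Degree≤ (p *P q) (d ℕ.+ e)
*P-degree≤ []      q                     p≤d q≤e i       _         = refl
*P-degree≤ (a ∷ p) q {zero}  {e}         p≤d q≤e i       e<i       = begin
  coeff ((a ∷ p) *P q) i                    ≡⟨ coeff-*P-∷ a p q i ⟩
  a * coeff q i + coeff (0ℚ ∷ (p *P q)) i   ≡⟨ cong₂ (λ x y → a * x + y) (q≤e i e<i) (shift-zero (*P-zeroˡ p q (Degree≤0⇒tail≈0 a p p≤d)) i) ⟩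
  a * 0ℚ + 0ℚ                               ≡⟨ cong (_+ 0ℚ) (ℚ.*-zeroʳ a) ⟩
  0ℚ                                        ∎
  where open ≡-Reasoning
*P-degree≤ (a ∷ p) q {suc d} {e}         p≤d q≤e (suc i) (s≤s d+e<i) = begin
  coeff ((a ∷ p) *P q) (suc i)              ≡⟨ coeff-*P-∷ a p q (suc i) ⟩
  a * coeff q (suc i) + coeff (p *P q) i    ≡⟨ cong₂ (λ x y → a * x + y) (q≤e (suc i) e<1+i)
                                                     (*P-degree≤ p q (λ j d<j → p≤d (suc j) (s≤s d<j)) q≤e i d+e<i) ⟩
  a * 0ℚ + 0ℚ                               ≡⟨ cong (_+ 0ℚ) (ℚ.*-zeroʳ a) ⟩
  0ℚ                                        ∎
  where
  open ≡-Reasoning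
  e<1+i : e < suc i
  e<1+i = s≤s (ℕ.≤-trans (ℕ.m≤n+m e d) (ℕ.<⇒≤ d+e<i))

*P-leading : ∀ p q {d e} → Degree≤ p d → Degree≤ q e → coeff (p *P q) (d ℕ.+ e) ≡ coeff p d * coeff q e
*P-leading []      q {e = e}             p≤d q≤e = sym (ℚ.*-zeroˡ (coeff q e))
*P-leading (a ∷ p) q {zero}  {e}         p≤d q≤e = begin
  coeff ((a ∷ p) *P q) e                    ≡⟨ coeff-*P-∷ a p q e ⟩
  a * coeff q e + coeff (0ℚ ∷ (p *P q)) e   ≡⟨ cong (a * coeff q e +_) (shift-zero (*P-zeroˡ p q (Degree≤0⇒tail≈0 a p p≤d)) e) ⟩
  a * coeff q e + 0ℚ                        ≡⟨ ℚ.+-identityʳ _ ⟩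
  a * coeff q e                             ∎
  where open ≡-Reasoning
*P-leading (a ∷ p) q {suc d} {e}         p≤d q≤e = begin
  coeff ((a ∷ p) *P q) (suc (d ℕ.+ e))          ≡⟨ coeff-*P-∷ a p q (suc (d ℕ.+ e)) ⟩
  a * coeff q (suc (d ℕ.+ e)) + coeff (p *P q) (d ℕ.+ e)
      ≡⟨ cong₂ (λ x y → a * x + y) (q≤e _ (s≤s (ℕ.m≤n+m e d))) (*P-leading p q (λ j d<j → p≤d (suc j) (s≤s d<j)) q≤e) ⟩
  a * 0ℚ + coeff p d * coeff q e                ≡⟨ cong (_+ coeff p d * coeff q e) (ℚ.*-zeroʳ a) ⟩
  0ℚ + coeff p d * coeff q e                    ≡⟨ ℚ.+-identityˡ _ ⟩
  coeff p d * coeff q e                         ∎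
  where open ≡-Reasoning

HasDegree-*P : ∀ {p q d e} → HasDegree p d → HasDegree q e → HasDegree (p *P q) (d ℕ.+ e)
HasDegree-*P {p} {q} (hasDegree p_d≢0 p≤d) (hasDegree q_e≢0 q≤e) =
  hasDegree (*-≢0 p_d≢0 q_e≢0 ∘ trans (sym (*P-leading p q p≤d q≤e))) (*P-degree≤ p q p≤d q≤e)

cofactor-degree : ∀ {g k E d t} → g *P k ≈P E → HasDegree g d → HasDegree E t → ∃ λ e → HasDegree k e × d ℕ.+ e ≡ t
cofactor-degree {g} {k} {E} {d} {t} gk≈E deg-g deg-E with degree? k
... | inj₁ k≈0       = ⊥-elim (leading≢0 deg-E (trans (sym (gk≈E t)) (*P-zeroʳ g k≈0 t)))
... | inj₂ (e , deg-k) = e , deg-k , HasDegree-unique (HasDegree-≈P gk≈E (HasDegree-*P deg-g deg-k)) deg-E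

monomial : ℕ → Poly
monomial n = fold oneP (0ℚ ∷_) n

HasDegree-oneP : HasDegree oneP 0
HasDegree-oneP = hasDegree (λ ()) λ { (suc i) _ → refl }

HasDegree-shift : ∀ {p d} → HasDegree p d → HasDegree (0ℚ ∷ p) (suc d)
HasDegree-shift (hasDegree p_d≢0 p≤d) = hasDegree p_d≢0 λ { (suc i) (s≤s d<i) → p≤d i d<i }

HasDegree-fold-shift : ∀ n {p d} → HasDegree p d → HasDegree (fold p (0ℚ ∷_) n) (n ℕ.+ d)
HasDegree-fold-shift zero    deg-p = deg-p
HasDegree-fold-shift (suc n) deg-p = HasDegree-shift (HasDegree-fold-shift n deg-p)

HasDegree-monomial : ∀ n → HasDegree (monomial n) n
HasDegree-monomial zero    = HasDegree-oneP
HasDegree-monomial (suc n) = HasDegree-shift (HasDegree-monomial n)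

Degree≤-scaleP : ∀ a p {d} → Degree≤ p d → Degree≤ (scaleP a p) d
Degree≤-scaleP a p p≤d i d<i = trans (coeff-scaleP a p i) (trans (cong (a *_) (p≤d i d<i)) (ℚ.*-zeroʳ a))

HasDegree-scaleP : ∀ {a p d} → a ≢ 0ℚ → HasDegree p d → HasDegree (scaleP a p) d
HasDegree-scaleP {a} {p} {d} a≢0 (hasDegree p_d≢0 p≤d) =
  hasDegree (*-≢0 a≢0 p_d≢0 ∘ trans (sym (coeff-scaleP a p d))) (Degree≤-scaleP a p p≤d)

HasDegree-+P : ∀ {p} q {d e} → HasDegree p d → Degree≤ q e → e < d → HasDegree (p +P q) d
HasDegree-+P {p} q {d} (hasDegree p_d≢0 p≤d) q≤e e<d = hasDegree leading vanishing
  where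
  leading : coeff (p +P q) d ≢ 0ℚ
  leading p+q_d≡0 = p_d≢0 (begin
    coeff p d                ≡⟨ ℚ.+-identityʳ (coeff p d) ⟨
    coeff p d + 0ℚ           ≡⟨ cong (coeff p d +_) (q≤e d e<d) ⟨
    coeff p d + coeff q d    ≡⟨ coeff-+P p q d ⟨
    coeff (p +P q) d         ≡⟨ p+q_d≡0 ⟩
    0ℚ                       ∎)
    where open ≡-Reasoning
  vanishing : Degree≤ (p +P q) d
  vanishing i d<i = trans (coeff-+P p q i) (cong₂ _+_ (p≤d i d<i) (q≤e i (ℕ.<-trans e<d d<i)))

HasDegree-monomial+1 : ∀ n → HasDegree (monomial n +P oneP) n
HasDegree-monomial+1 zero    = hasDegree (λ ()) λ { (suc i) _ → refl }
HasDegree-monomial+1 (suc n) = HasDegree-+P oneP (HasDegree-monomial (suc n)) (degree≤ HasDegree-oneP) (s≤s z≤n)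

square-factor-divides : ∀ M g h → fPoly (suc M) ≈P g *P g *P h →
                        ∃ λ Q → g *P Q ≈P scaleP (ℕ→ℚ (suc M)) (monomial M +P oneP)
square-factor-divides M g h f≈g²h = Q , λ k → trans (cong (λ r → coeff r k) (sym (act≡*P g Q))) (sym (proj₂ image k))
  where
  image : ∃ λ z → scaleP (ℕ→ℚ (suc M)) (monomial M +P oneP) ≈P P.act g z
  image = P.square-factor-image M g h oneP f≈g²h
  Q : Poly
  Q = proj₁ image

-- The cyclic shift and its inner product

p*p≥0 : ∀ p → 0ℚ ℚ.≤ p * p
p*p≥0 p with ℚ.≤-total 0ℚ p
... | inj₁ 0≤p = ℚ.nonNegative⁻¹ _ {{ℚ.nonNeg*nonNeg⇒nonNeg p {{ℚ.nonNegative 0≤p}} p {{ℚ.nonNegative 0≤p}}}}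
... | inj₂ p≤0 = ℚ.nonNegative⁻¹ _ {{ℚ.nonPos*nonPos⇒nonPos p {{ℚ.nonPositive p≤0}} p {{ℚ.nonPositive p≤0}}}}

p*p≡0⇒p≡0 : ∀ {p} → p * p ≡ 0ℚ → p ≡ 0ℚ
p*p≡0⇒p≡0 {p} pp≡0 with p ℚ.≟ 0ℚ
... | yes p≡0 = p≡0
... | no  p≢0 = ⊥-elim (*-≢0 p≢0 p≢0 pp≡0)

nonNeg+nonNeg≡0⇒≡0 : ∀ {p q} → 0ℚ ℚ.≤ p → 0ℚ ℚ.≤ q → p + q ≡ 0ℚ → p ≡ 0ℚ
nonNeg+nonNeg≡0⇒≡0 {p} {q} 0≤p 0≤q p+q≡0 = ℚ.≤-antisym p≤0 0≤p
  where
  open ℚ.≤-Reasoning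
  p≤0 : p ℚ.≤ 0ℚ
  p≤0 = begin
    p        ≡⟨ ℚ.+-identityʳ p ⟨
    p + 0ℚ   ≤⟨ ℚ.+-monoʳ-≤ p 0≤q ⟩
    p + q    ≡⟨ p+q≡0 ⟩
    0ℚ       ∎

∑< : ℕ → (ℕ → ℚ) → ℚ
∑< zero    f = 0ℚ
∑< (suc n) f = ∑< n f + f n

∑<-cong : ∀ n {f g} → (∀ i → i < n → f i ≡ g i) → ∑< n f ≡ ∑< n g
∑<-cong zero    f≡g = refl
∑<-cong (suc n) f≡g = cong₂ _+_ (∑<-cong n (λ i i<n → f≡g i (ℕ.m<n⇒m<1+n i<n))) (f≡g n (ℕ.n<1+n n))

∑<-+ : ∀ n (f g : ℕ → ℚ) → ∑< n (λ i → f i + g i) ≡ ∑< n f + ∑< n g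
∑<-+ zero    f g = refl
∑<-+ (suc n) f g = trans (cong (_+ (f n + g n)) (∑<-+ n f g)) (+-interchange (∑< n f) (∑< n g) (f n) (g n))
  where
  open +-*-Solver
  +-interchange : ∀ a b c d → (a + b) + (c + d) ≡ (a + c) + (b + d)
  +-interchange = solve 4 (λ a b c d → (a :+ b) :+ (c :+ d) := (a :+ c) :+ (b :+ d)) refl

∑<-*ˡ : ∀ n a (f : ℕ → ℚ) → ∑< n (λ i → a * f i) ≡ a * ∑< n f
∑<-*ˡ zero    a f = sym (ℚ.*-zeroʳ a)
∑<-*ˡ (suc n) a f = trans (cong (_+ a * f n) (∑<-*ˡ n a f)) (sym (ℚ.*-distribˡ-+ a (∑< n f) (f n)))

∑<-suc : ∀ n (f : ℕ → ℚ) → ∑< (suc n) f ≡ f 0 + ∑< n (f ∘ suc)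
∑<-suc zero    f = ℚ.+-comm 0ℚ (f 0)
∑<-suc (suc n) f = trans (cong (_+ f (suc n)) (∑<-suc n f)) (ℚ.+-assoc (f 0) _ (f (suc n)))

∑<-nonNeg : ∀ n {f} → (∀ i → i < n → 0ℚ ℚ.≤ f i) → 0ℚ ℚ.≤ ∑< n f
∑<-nonNeg zero    f≥0 = ℚ.≤-refl
∑<-nonNeg (suc n) f≥0 = ℚ.+-mono-≤ (∑<-nonNeg n (λ i i<n → f≥0 i (ℕ.m<n⇒m<1+n i<n))) (f≥0 n (ℕ.n<1+n n))

∑<-squares≡0 : ∀ n (f : ℕ → ℚ) → ∑< n (λ i → f i * f i) ≡ 0ℚ → ∀ i → i < n → f i ≡ 0ℚ
∑<-squares≡0 (suc n) f sum≡0 i i<1+n =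
  [ ∑<-squares≡0 n f S≡0 i , (λ { refl → p*p≡0⇒p≡0 fₙ²≡0 }) ]′ (ℕ.m<1+n⇒m<n∨m≡n i<1+n)
  where
  S≥0 : 0ℚ ℚ.≤ ∑< n (λ j → f j * f j)
  S≥0 = ∑<-nonNeg n (λ j _ → p*p≥0 (f j))
  S≡0 : ∑< n (λ j → f j * f j) ≡ 0ℚ
  S≡0 = nonNeg+nonNeg≡0⇒≡0 S≥0 (p*p≥0 (f n)) sum≡0
  fₙ²≡0 : f n * f n ≡ 0ℚ
  fₙ²≡0 = nonNeg+nonNeg≡0⇒≡0 (p*p≥0 (f n)) S≥0 (trans (ℚ.+-comm (f n * f n) _) sum≡0)

-1*p≡p⇒p≡0 : ∀ {p} → - 1ℚ * p ≡ p → p ≡ 0ℚ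
-1*p≡p⇒p≡0 {p} -p≡p = p≢0⇒p*q≡0⇒q≡0 {1ℚ + 1ℚ} (λ ()) (begin
  (1ℚ + 1ℚ) * p       ≡⟨ double p ⟩
  p + p               ≡⟨ cong (p +_) -p≡p ⟨
  p + - 1ℚ * p        ≡⟨ cancel p ⟩
  0ℚ                  ∎)
  where
  open ≡-Reasoning
  open +-*-Solver
  double : ∀ p → (1ℚ + 1ℚ) * p ≡ p + p
  double = solve 1 (λ p → (con 1ℚ :+ con 1ℚ) :* p := p :+ p) refl
  cancel : ∀ p → p + - 1ℚ * p ≡ 0ℚ
  cancel = solve 1 (λ p → p :+ (:- con 1ℚ) :* p := con 0ℚ) refl

δ : ℕ → ℕ → ℚ
δ zero    zero    = 1ℚ
δ zero    (suc i) = 0ℚ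
δ (suc j) zero    = 0ℚ
δ (suc j) (suc i) = δ j i

δ-diag : ∀ j → δ j j ≡ 1ℚ
δ-diag zero    = refl
δ-diag (suc j) = δ-diag j

δ-off : ∀ j i → j ≢ i → δ j i ≡ 0ℚ
δ-off zero    zero    j≢i = ⊥-elim (j≢i refl)
δ-off zero    (suc i) j≢i = refl
δ-off (suc j) zero    j≢i = refl
δ-off (suc j) (suc i) j≢i = δ-off j i (j≢i ∘ cong suc)

sign : ℕ → ℚ
sign zero    = 1ℚ
sign (suc j) = - sign j

sign-even : ∀ m → sign (m ℕ.+ m) ≡ 1ℚ
sign-even zero    = refl
sign-even (suc m) = begin
  sign (suc m ℕ.+ suc m)   ≡⟨ cong (λ k → - sign k) (ℕ.+-suc m m) ⟩
  - - sign (m ℕ.+ m)       ≡⟨ neg-involutive _ ⟩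
  sign (m ℕ.+ m)           ≡⟨ sign-even m ⟩
  1ℚ                       ∎
  where
  open ≡-Reasoning
  open +-*-Solver
  neg-involutive : ∀ x → - - x ≡ x
  neg-involutive = solve 1 (λ x → :- :- x := x) refl

fold-comm : ∀ {A : Set} (f : A → A) n x → fold (f x) f n ≡ f (fold x f n)
fold-comm f zero    x = refl
fold-comm f (suc n) x = cong f (fold-comm f n x)

module Cyclic (N′ : ℕ) where
  N : ℕ
  N = suc N′

  rotate : (ℕ → ℚ) → ℕ → ℚ
  rotate v zero    = v N′
  rotate v (suc i) = v i

  -- Vectors are functions ℕ → ℚ whose entries from N on are ignored. Equality is a record
  -- (rather than a function type) so that Agda can infer the vectors it relates.
  infix 4 _≋_
  record _≋_ (v w : ℕ → ℚ) : Set where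
    constructor pointwise
    field at : ∀ i → i < N → v i ≡ w i

  cyclic : ℚ[X]-Module
  cyclic = record
    { V             = ℕ → ℚ
    ; _≈_           = _≋_
    ; isEquivalence = record
      { refl  = pointwise λ _ _ → refl
      ; sym   = λ (pointwise v≈w) → pointwise λ i i<N → sym (v≈w i i<N)
      ; trans = λ (pointwise u≈v) (pointwise v≈w) → pointwise λ i i<N → trans (u≈v i i<N) (v≈w i i<N) }
    ; 0v            = λ _ → 0ℚ
    ; _⊕_           = λ v w i → v i + w i
    ; _·_           = λ a v i → a * v i
    ; T             = rotate
    ; ⊕-cong        = λ (pointwise v≈) (pointwise w≈) → pointwise λ i i<N → cong₂ _+_ (v≈ i i<N) (w≈ i i<N)
    ; ·-congˡ       = λ {a} (pointwise v≈w) → pointwise λ i i<N → cong (a *_) (v≈w i i<N)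
    ; T-cong        = λ (pointwise v≈w) → pointwise λ { zero _ → v≈w N′ (ℕ.n<1+n N′)
                                                      ; (suc i) (s≤s i<N′) → v≈w i (ℕ.m<n⇒m<1+n i<N′) }
    ; ⊕-assoc       = λ u v w → pointwise λ i _ → ℚ.+-assoc (u i) (v i) (w i)
    ; ⊕-comm        = λ v w → pointwise λ i _ → ℚ.+-comm (v i) (w i)
    ; ⊕-identityˡ   = λ v → pointwise λ i _ → ℚ.+-identityˡ (v i)
    ; ·-distribˡ-⊕  = λ a v w → pointwise λ i _ → ℚ.*-distribˡ-+ a (v i) (w i)
    ; ·-distribʳ-+  = λ a b v → pointwise λ i _ → ℚ.*-distribʳ-+ (v i) a b
    ; ·-assoc       = λ a b v → pointwise λ i _ → ℚ.*-assoc a b (v i)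
    ; ·-identityˡ   = λ v → pointwise λ i _ → ℚ.*-identityˡ (v i)
    ; ·-zeroˡ       = λ v → pointwise λ i _ → ℚ.*-zeroˡ (v i)
    ; T-⊕           = λ v w → pointwise λ { zero _ → refl ; (suc i) _ → refl }
    ; T-·           = λ a v → pointwise λ { zero _ → refl ; (suc i) _ → refl }
    }

  open SquareFactor cyclic public

  rotate^-δ₀ : ∀ j → j < N → fold (δ 0) T j ≈ δ j
  rotate^-δ₀ zero    _             = ≈-refl
  rotate^-δ₀ (suc j) (s≤s j<N′) = ≈-trans (T-cong (rotate^-δ₀ j (ℕ.m<n⇒m<1+n j<N′))) step
    where
    step : rotate (δ j) ≈ δ (suc j)
    step = pointwise λ { zero _ → δ-off j N′ (ℕ.<⇒≢ j<N′) ; (suc i) _ → refl }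

  rotate^N-δ₀ : fold (δ 0) T N ≈ δ 0
  rotate^N-δ₀ = ≈-trans (T-cong (rotate^-δ₀ N′ (ℕ.n<1+n N′))) step
    where
    step : rotate (δ N′) ≈ δ 0
    step = pointwise λ { zero _ → δ-diag N′ ; (suc i) (s≤s i<N′) → δ-off N′ i (ℕ.>⇒≢ i<N′) }

  act-δ₀ : ∀ K → (∀ j → N ≤ j → coeff K j ≡ 0ℚ) → ∀ i → i < N → act K (δ 0) i ≡ coeff K i
  act-δ₀ []      K≥N≡0 i       _          = refl
  act-δ₀ (a ∷ K) K≥N≡0 zero    _          = begin
    a * 1ℚ + act K (δ 0) N′   ≡⟨ cong (a * 1ℚ +_) (act-δ₀ K (λ j N≤j → K≥N≡0 (suc j) (ℕ.m≤n⇒m≤1+n N≤j)) N′ (ℕ.n<1+n N′)) ⟩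
    a * 1ℚ + coeff K N′       ≡⟨ cong (a * 1ℚ +_) (K≥N≡0 N ℕ.≤-refl) ⟩
    a * 1ℚ + 0ℚ               ≡⟨ trans (ℚ.+-identityʳ _) (ℚ.*-identityʳ a) ⟩
    a                         ∎
    where open ≡-Reasoning
  act-δ₀ (a ∷ K) K≥N≡0 (suc i) (s≤s i<N′) = begin
    a * 0ℚ + act K (δ 0) i    ≡⟨ cong (_+ act K (δ 0) i) (ℚ.*-zeroʳ a) ⟩
    0ℚ + act K (δ 0) i        ≡⟨ ℚ.+-identityˡ _ ⟩
    act K (δ 0) i             ≡⟨ act-δ₀ K (λ j N≤j → K≥N≡0 (suc j) (ℕ.m≤n⇒m≤1+n N≤j)) i (ℕ.m<n⇒m<1+n i<N′) ⟩
    coeff K i                 ∎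
    where open ≡-Reasoning

  ⟪_,_⟫ : V → V → ℚ
  ⟪ v , w ⟫ = ∑< N (λ i → v i * w i)

  ⟪⟫-cong : ∀ {v v′ w w′} → v ≈ v′ → w ≈ w′ → ⟪ v , w ⟫ ≡ ⟪ v′ , w′ ⟫
  ⟪⟫-cong (pointwise v≈v′) (pointwise w≈w′) = ∑<-cong N (λ i i<N → cong₂ _*_ (v≈v′ i i<N) (w≈w′ i i<N))

  ⟪⟫-comm : ∀ v w → ⟪ v , w ⟫ ≡ ⟪ w , v ⟫
  ⟪⟫-comm v w = ∑<-cong N (λ i _ → ℚ.*-comm (v i) (w i))

  ⟪⟫-⊕ˡ : ∀ u v w → ⟪ u ⊕ v , w ⟫ ≡ ⟪ u , w ⟫ + ⟪ v , w ⟫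
  ⟪⟫-⊕ˡ u v w = trans (∑<-cong N (λ i _ → ℚ.*-distribʳ-+ (w i) (u i) (v i))) (∑<-+ N _ _)

  ⟪⟫-·ˡ : ∀ a v w → ⟪ a · v , w ⟫ ≡ a * ⟪ v , w ⟫
  ⟪⟫-·ˡ a v w = trans (∑<-cong N (λ i _ → ℚ.*-assoc a (v i) (w i))) (∑<-*ˡ N a _)

  ⟪⟫-⊕-·ʳ : ∀ u a v w → ⟪ u , v ⊕ a · w ⟫ ≡ ⟪ u , v ⟫ + a * ⟪ u , w ⟫
  ⟪⟫-⊕-·ʳ u a v w = begin
    ⟪ u , v ⊕ a · w ⟫                 ≡⟨ ⟪⟫-comm u _ ⟩
    ⟪ v ⊕ a · w , u ⟫                 ≡⟨ ⟪⟫-⊕ˡ v (a · w) u ⟩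
    ⟪ v , u ⟫ + ⟪ a · w , u ⟫         ≡⟨ cong₂ _+_ (⟪⟫-comm v u) (trans (⟪⟫-·ˡ a w u) (cong (a *_) (⟪⟫-comm w u))) ⟩
    ⟪ u , v ⟫ + a * ⟪ u , w ⟫         ∎
    where open ≡-Reasoning

  ⟪⟫-rotate : ∀ v w → ⟪ T v , T w ⟫ ≡ ⟪ v , w ⟫
  ⟪⟫-rotate v w = trans (∑<-suc N′ (λ i → rotate v i * rotate w i)) (ℚ.+-comm (v N′ * w N′) _)

  ⟪⟫-U : ∀ v w → ⟪ U v , w ⟫ ≡ - ⟪ T v , U w ⟫
  ⟪⟫-U v w = begin
    ⟪ U v , w ⟫                                 ≡⟨ ⟪⟫-cong (U-defn v) ≈-refl ⟩
    ⟪ v ⊕ (- 1ℚ) · T v , w ⟫                    ≡⟨ trans (⟪⟫-⊕ˡ v _ w) (cong (⟪ v , w ⟫ +_) (⟪⟫-·ˡ (- 1ℚ) (T v) w)) ⟩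
    ⟪ v , w ⟫ + - 1ℚ * ⟪ T v , w ⟫              ≡⟨ rearrange ⟪ v , w ⟫ ⟪ T v , w ⟫ ⟩
    - (⟪ T v , w ⟫ + - 1ℚ * ⟪ v , w ⟫)          ≡⟨ cong (λ x → - (⟪ T v , w ⟫ + - 1ℚ * x)) (⟪⟫-rotate v w) ⟨
    - (⟪ T v , w ⟫ + - 1ℚ * ⟪ T v , T w ⟫)      ≡⟨ cong -_ (⟪⟫-⊕-·ʳ (T v) (- 1ℚ) w (T w)) ⟨
    - ⟪ T v , w ⊕ (- 1ℚ) · T w ⟫                ≡⟨ cong -_ (⟪⟫-cong (≈-refl {T v}) (U-defn w)) ⟨
    - ⟪ T v , U w ⟫                             ∎
    where
    open ≡-Reasoning
    open +-*-Solver
    rearrange : ∀ x y → x + - 1ℚ * y ≡ - (y + - 1ℚ * x)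
    rearrange = solve 2 (λ x y → x :+ (:- con 1ℚ) :* y := :- (y :+ (:- con 1ℚ) :* x)) refl

  ⟪⟫-U^ : ∀ j v w → ⟪ fold v U j , w ⟫ ≡ sign j * ⟪ fold v T j , fold w U j ⟫
  ⟪⟫-U^ zero    v w = sym (ℚ.*-identityˡ _)
  ⟪⟫-U^ (suc j) v w = begin
    ⟪ U (fold v U j) , w ⟫                              ≡⟨ ⟪⟫-U (fold v U j) w ⟩
    - ⟪ T (fold v U j) , U w ⟫                          ≡⟨ cong -_ (⟪⟫-cong (T-fold-act oneMinusX j v) ≈-refl) ⟩
    - ⟪ fold (T v) U j , U w ⟫                          ≡⟨ cong -_ (⟪⟫-U^ j (T v) (U w)) ⟩
    - (sign j * ⟪ fold (T v) T j , fold (U w) U j ⟫)    ≡⟨ cong₂ (λ x y → - (sign j * ⟪ x , y ⟫)) (fold-comm T j v) (fold-comm U j w) ⟩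
    - (sign j * ⟪ T (fold v T j) , U (fold w U j) ⟫)    ≡⟨ ℚ.neg-distribˡ-* (sign j) _ ⟩
    - sign j * ⟪ T (fold v T j) , U (fold w U j) ⟫      ∎
    where open ≡-Reasoning

  -- T is orthogonal, so the adjoint of U = 1 − T is −T⁻¹U (⟪⟫-U) and, M being even,
  -- ⟪ U^M r , r ⟫ = ⟪ T^M r , U^M r ⟫; for the eigenvalue −1 the two sides are −|r|² and |r|².
  even-eigenvector≈0 : ∀ m {r} → fold r T (m ℕ.+ m) ≈ (- 1ℚ) · r → fold r U (m ℕ.+ m) ≈ (- 1ℚ) · r → r ≈ 0v
  even-eigenvector≈0 m {r} T^Mr≈-r U^Mr≈-r = pointwise (∑<-squares≡0 N r (-1*p≡p⇒p≡0 (begin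
    - 1ℚ * ⟪ r , r ⟫                              ≡⟨ ⟪⟫-·ˡ (- 1ℚ) r r ⟨
    ⟪ (- 1ℚ) · r , r ⟫                            ≡⟨ ⟪⟫-cong U^Mr≈-r ≈-refl ⟨
    ⟪ fold r U M , r ⟫                            ≡⟨ ⟪⟫-U^ M r r ⟩
    sign M * ⟪ fold r T M , fold r U M ⟫          ≡⟨ cong₂ _*_ (sign-even m) (⟪⟫-cong T^Mr≈-r U^Mr≈-r) ⟩
    1ℚ * ⟪ (- 1ℚ) · r , (- 1ℚ) · r ⟫              ≡⟨ cong (1ℚ *_) (⟪⟫-·ˡ (- 1ℚ) r _) ⟩
    1ℚ * (- 1ℚ * ⟪ r , (- 1ℚ) · r ⟫)              ≡⟨ cong (λ x → 1ℚ * (- 1ℚ * x)) (trans (⟪⟫-comm r _) (⟪⟫-·ˡ (- 1ℚ) r r)) ⟩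
    1ℚ * (- 1ℚ * (- 1ℚ * ⟪ r , r ⟫))              ≡⟨ simplify ⟪ r , r ⟫ ⟩
    ⟪ r , r ⟫                                     ∎)))
    where
    open ≡-Reasoning
    M : ℕ
    M = m ℕ.+ m
    open +-*-Solver
    simplify : ∀ s → 1ℚ * (- 1ℚ * (- 1ℚ * s)) ≡ s
    simplify = solve 1 (λ s → con 1ℚ :* ((:- con 1ℚ) :* ((:- con 1ℚ) :* s)) := s) refl

  -- g (x^M − 1) Q = n (x^{2M} − 1), and T^{2M} = 1 on ℚ^{2M}.
  divides-xᴹ+1⇒annihilates : ∀ M g Q → M ℕ.+ M ≡ N → g *P Q ≈P scaleP (ℕ→ℚ (suc M)) (monomial M +P oneP) →
                             act g (act (fold Q (0ℚ ∷_) M +P scaleP (- 1ℚ) Q) (δ 0)) ≈ 0v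
  divides-xᴹ+1⇒annihilates M g Q M+M≡N gQ≈P = begin
    act g (act (fold Q (0ℚ ∷_) M +P scaleP (- 1ℚ) Q) δ₀)
      ≈⟨ act-cong g (≈-trans (act-+P (fold Q (0ℚ ∷_) M) (scaleP (- 1ℚ) Q) δ₀) (⊕-cong (act-fold-shift M Q δ₀) (act-scaleP (- 1ℚ) Q δ₀))) ⟩
    act g (fold y₀ T M ⊕ (- 1ℚ) · y₀)
      ≈⟨ ≈-trans (act-⊕ g _ _) (⊕-cong (act-fold-T g M y₀) (act-· g (- 1ℚ) y₀)) ⟩
    fold (act g y₀) T M ⊕ (- 1ℚ) · act g y₀
      ≈⟨ ⊕-cong (fold-cong M T-cong gy₀≈y) (·-congˡ {a = - 1ℚ} gy₀≈y) ⟩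
    fold y T M ⊕ (- 1ℚ) · y
      ≈⟨ ⊕-cong T^My≈ ≈-refl ⟩
    c · (δ₀ ⊕ t) ⊕ (- 1ℚ) · (c · (t ⊕ δ₀))
      ≈⟨ pointwise (λ i _ → cancel c (δ₀ i) (t i)) ⟩
    0v
      ∎
    where
    open ≈-Reasoning
    c : ℚ
    c = ℕ→ℚ (suc M)
    δ₀ y₀ t y : V
    δ₀ = δ 0
    y₀ = act Q δ₀
    t = fold δ₀ T M
    y = c · (t ⊕ δ₀)
    gy₀≈y : act g y₀ ≈ y
    gy₀≈y = begin
      act g (act Q δ₀)                              ≈⟨ act-*P g Q δ₀ ⟨
      act (g *P Q) δ₀                               ≈⟨ act-≈P (g *P Q) (scaleP c (monomial M +P oneP)) δ₀ gQ≈P ⟩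
      act (scaleP c (monomial M +P oneP)) δ₀        ≈⟨ ≈-trans (act-scaleP c (monomial M +P oneP) δ₀) (·-congˡ {c} (act-+P (monomial M) oneP δ₀)) ⟩
      c · (act (monomial M) δ₀ ⊕ act oneP δ₀)       ≈⟨ ·-congˡ {c} (⊕-cong (≈-trans (act-fold-shift M oneP δ₀) (fold-cong M T-cong (act-oneP δ₀))) (act-oneP δ₀)) ⟩
      y                                             ∎
    T^My≈ : fold y T M ≈ c · (δ₀ ⊕ t)
    T^My≈ = begin
      fold (c · (t ⊕ δ₀)) T M                      ≈⟨ ≈-trans (fold-T-· c M (t ⊕ δ₀)) (·-congˡ {c} (fold-T-⊕ M t δ₀)) ⟩
      c · (fold t T M ⊕ t)                         ≈⟨ ·-congˡ {c} (⊕-cong T^Mt≈δ₀ ≈-refl) ⟩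
      c · (δ₀ ⊕ t)                                 ∎
      where
      T^Mt≈δ₀ : fold t T M ≈ δ₀
      T^Mt≈δ₀ = ≈-trans (≈-reflexive (sym (fold-+ δ₀ T M {M}))) (subst (λ k → fold δ₀ T k ≈ δ₀) (sym M+M≡N) rotate^N-δ₀)
    cancel : ∀ c d x → c * (d + x) + - 1ℚ * (c * (x + d)) ≡ 0ℚ
    cancel = solve 3 (λ c d x → c :* (d :+ x) :+ (:- con 1ℚ) :* (c :* (x :+ d)) := con 0ℚ) refl
      where open +-*-Solver

odd⇒≡1+m+m : ∀ n → n % 2 ≡ 1 → ∃ λ m → n ≡ suc (m ℕ.+ m)
odd⇒≡1+m+m n n%2≡1 = n / 2 , (begin
  n                               ≡⟨ m≡m%n+[m/n]*n n 2 ⟩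
  n % 2 ℕ.+ n / 2 ℕ.* 2           ≡⟨ cong (ℕ._+ n / 2 ℕ.* 2) n%2≡1 ⟩
  suc (n / 2 ℕ.* 2)               ≡⟨ cong suc (ℕ.*-comm (n / 2) 2) ⟩
  suc (n / 2 ℕ.+ (n / 2 ℕ.+ 0))   ≡⟨ cong (λ k → suc (n / 2 ℕ.+ k)) (ℕ.+-identityʳ (n / 2)) ⟩
  suc (n / 2 ℕ.+ n / 2)           ∎)
  where open ≡-Reasoning

no-square-factor-dividing-xᴹ+1 : ∀ m′ g h Q {e} → let M = suc m′ ℕ.+ suc m′ in
  fPoly (suc M) ≈P g *P g *P h → g *P Q ≈P scaleP (ℕ→ℚ (suc M)) (monomial M +P oneP) → HasDegree Q e → e < M → ⊥
no-square-factor-dividing-xᴹ+1 m′ g h Q {e} f≈g²h gQ≈P deg-Q e<M =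
  leading≢0 deg-K (trans (sym (act-δ₀ K K≥N≡0 (M ℕ.+ e) M+e<N)) (_≋_.at r≈0 (M ℕ.+ e) M+e<N))
  where
  M : ℕ
  M = suc m′ ℕ.+ suc m′
  open Cyclic (m′ ℕ.+ suc m′ ℕ.+ M)
  K : Poly
  K = fold Q (0ℚ ∷_) M +P scaleP (- 1ℚ) Q
  deg-K : HasDegree K (M ℕ.+ e)
  deg-K = HasDegree-+P (scaleP (- 1ℚ) Q) (HasDegree-fold-shift M deg-Q) (Degree≤-scaleP (- 1ℚ) Q (degree≤ deg-Q))
                       (ℕ.m<n+m e (s≤s z≤n))
  M+e<N : M ℕ.+ e < N
  M+e<N = ℕ.+-monoʳ-< M e<M
  K≥N≡0 : ∀ j → N ℕ.≤ j → coeff K j ≡ 0ℚ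
  K≥N≡0 j N≤j = degree≤ deg-K j (ℕ.<-≤-trans M+e<N N≤j)
  r≈0 : act K (δ 0) ≈ 0v
  r≈0 = even-eigenvector≈0 (suc m′) (proj₁ kernel) (proj₂ kernel)
    where
    kernel : fold (act K (δ 0)) T M ≈ (- 1ℚ) · act K (δ 0) × fold (act K (δ 0)) U M ≈ (- 1ℚ) · act K (δ 0)
    kernel = square-factor-kernel M g h f≈g²h (divides-xᴹ+1⇒annihilates M g Q refl gQ≈P)

square-factor-cofactor : ∀ M g h {d} → fPoly (suc M) ≈P g *P g *P h → HasDegree g d →
                         ∃₂ λ Q e → g *P Q ≈P scaleP (ℕ→ℚ (suc M)) (monomial M +P oneP) × HasDegree Q e × d ℕ.+ e ≡ M
square-factor-cofactor M g h f≈g²h deg-g =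
  let Q , gQ≈P = square-factor-divides M g h f≈g²h
      e , deg-Q , d+e≡M = cofactor-degree gQ≈P deg-g (HasDegree-scaleP (ℕ→ℚ-suc≢0 M) (HasDegree-monomial+1 M))
  in  Q , e , gQ≈P , deg-Q , d+e≡M

square-factor-degree≡0 : ∀ m g h {d} → fPoly (suc (m ℕ.+ m)) ≈P g *P g *P h → HasDegree g d → d ≡ 0
square-factor-degree≡0 m        g h {zero}  _     _     = refl
square-factor-degree≡0 zero     g h {suc d} f≈g²h deg-g =
  let _ , _ , _ , _ , 1+d+e≡0 = square-factor-cofactor 0 g h f≈g²h deg-g in ⊥-elim (ℕ.1+n≢0 1+d+e≡0)
square-factor-degree≡0 (suc m′) g h {suc d} f≈g²h deg-g =
  let Q , e , gQ≈P , deg-Q , 1+d+e≡M = square-factor-cofactor (suc m′ ℕ.+ suc m′) g h f≈g²h deg-g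
  in  ⊥-elim (no-square-factor-dividing-xᴹ+1 m′ g h Q f≈g²h gQ≈P deg-Q (subst (e <_) 1+d+e≡M (s≤s (ℕ.m≤n+m e d))))

mainTheorem7 : (n : ℕ) → n % 2 ≡ 1 → SquareFree (fPoly n)
mainTheorem7 n n%2≡1 g h f≈g²h k with odd⇒≡1+m+m n n%2≡1 | degree? g
... | m , refl | inj₁ g≈0         = g≈0 (suc k)
... | m , refl | inj₂ (d , deg-g) with square-factor-degree≡0 m g h f≈g²h deg-g
...   | refl = degree≤ deg-g (suc k) (s≤s z≤n)
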